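{- Let $N,h$ be positive integers with $1\leq h\leq 2N^2$, let $r$ be a divisor of $h$ with $r\leq N$, and set $m=h/r$ and $M=N/r$. For coprime positive integers $x,y\leq M$, let $b_0$ be the unique integer in $\{1,\dots,y\}$ with $b_0x\equiv m \pmod{y}$, let $d_0=(m-b_0x)/y$, and let \[ U = U(x,y)=\max\left\{\frac{1-b_0}{y}, \frac{d_0-N}{x}\right\}. \] Then for every $\varepsilon>0$, \[ \sum_{\substack{1\leq x,y\leq M \\ \gcd(x,y)=1}} \mathbf{1}_{\mathbb{Z}}(U) \cdot \mathbf{1}_{x+y> M} \ll_\varepsilon M m^\varepsilon, \] the sum being over positive integers $x,y$.
   Context: $\mathbf{1}_{\mathbb{Z}}(U)$ equals $1$ if $U$ is an integer and $0$ otherwise; $\mathbf{1}_{x+y>M}$ equals $1$ if $x+y>M$ and $0$ otherwise. $Y\ll_\varepsilon X$ means $|Y|\leq C_\varepsilon X$ with $C_\varepsilon$ depending only on $\varepsilon$. -}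

module Defs where

open import Data.Nat as ℕ using (ℕ; zero; suc; _+_; _*_; _≤_; _<_; _≤?_; _<?_; NonZero)
open import Data.Nat.DivMod using (_%_)
open import Data.Nat.GCD using (gcd)
open import Data.Integer as ℤ using (ℤ; +_)
open import Data.Rational as ℚ using (ℚ; _⊔_; floor)
open import Data.Rational.Properties using () renaming (_≟_ to _≟ℚ_)
open import Data.List using (List; []; _∷_; map; upTo; concatMap; filter; length)
open import Data.Product using (_×_; _,_)
open import Relation.Binary.PropositionalEquality using (_≡_)
open import Relation.Nullary using (Dec; yes; no)
open import Relation.Nullary.Decidable using (_×-dec_)

ℕ→ℚ : ℕ → ℚ
ℕ→ℚ n = (+ n) ℚ./ 1

ℤ→ℚ : ℤ → ℚ
ℤ→ℚ z = z ℚ./ 1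

IsInt : ℚ → Set
IsInt u = ℤ→ℚ (floor u) ≡ u

isInt? : (u : ℚ) → Dec (IsInt u)
isInt? u = ℤ→ℚ (floor u) ≟ℚ u

-- b0 : the unique b ∈ {1,…,y} with b*x ≡ m (mod y) (exists and is unique
-- when gcd(x,y)=1; the fallback value y is never used in that case)
b0-search : (x y m : ℕ) .{{_ : NonZero y}} → List ℕ → ℕ
b0-search x y m [] = y
b0-search x y m (b ∷ bs) with ((b * x) % y) ℕ.≟ (m % y)
... | yes _ = b
... | no _ = b0-search x y m bs

b₀ : (x y m : ℕ) .{{_ : NonZero y}} → ℕ
b₀ x y m = b0-search x y m (map suc (upTo y))

d₀ : (x y m : ℕ) .{{_ : NonZero y}} → ℚ
d₀ x y m = (+ m ℤ.- + (b₀ x y m * x)) ℚ./ y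

U : (N m x y : ℕ) .{{_ : NonZero x}} .{{_ : NonZero y}} → ℚ
U N m x y = ((ℤ.1ℤ ℤ.- + b₀ x y m) ℚ./ y)
          ⊔ ((d₀ x y m ℚ.- ℕ→ℚ N) ℚ.* (ℤ.1ℤ ℚ./ x))

-- summation condition for the pair (x,y) = (suc i, suc j), with M = N/r real:
-- gcd(x,y)=1, x ≤ N/r, y ≤ N/r, x+y > N/r, and U(x,y) ∈ ℤ
Cond : (N r m : ℕ) → ℕ × ℕ → Set
Cond N r m (i , j) =
  gcd (suc i) (suc j) ≡ 1 × (r * suc i ≤ N × (r * suc j ≤ N ×
  (N < r * (suc i + suc j) × IsInt (U N m (suc i) (suc j)))))

cond? : (N r m : ℕ) → (p : ℕ × ℕ) → Dec (Cond N r m p)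
cond? N r m (i , j) =
  (gcd (suc i) (suc j) ℕ.≟ 1) ×-dec ((r * suc i ≤? N) ×-dec ((r * suc j ≤? N) ×-dec
  ((N <? r * (suc i + suc j)) ×-dec isInt? (U N m (suc i) (suc j)))))

-- all pairs (i,j) with 0 ≤ i,j < N, i.e. (x,y) = (i+1,j+1) ∈ {1..N}²
-- (a superset of {1..M}², since r ≥ 1)
pairs : ℕ → List (ℕ × ℕ)
pairs N = concatMap (λ i → map (i ,_) (upTo N)) (upTo N)

S : (N r m : ℕ) → ℕ
S N r m = length (filter (cond? N r m) (pairs N))

-- If U(x, y) is an integer then, U being the larger of (1 - b₀)/y and (d₀ - N)/x,
-- either b₀ = 1, i.e. x ≡ m (mod y), or x ∣ m - N y. As x + y > M while x, y ≤ M, for fixed y the x of the first kind lie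
-- in a window of width y and are congruent mod y, so there is at most one of them;
-- for fixed x the y of the second kind lie in a window of width x and are congruent
-- modulo x / gcd(x, N), so there are at most gcd(x, N) ≤ gcd(x, m) of them. Writing
-- gcd(x, m) ≤ Σ_{d ∣ m, d ∣ x} d and summing over x ≤ M first gives
-- Σ_{x ≤ M} gcd(x, m) ≤ M τ(m), hence r S ≤ N + N τ(m) ≤ 2 N τ(m). Finally the
-- divisor bound τ(m)^q ≤ (q^q)^(2^q) m gives the claim with ε = p / q: a prime power
-- p^a contributes (a + 1)^q to τ(m)^q, which is at most p^a if p ≥ 2^q and at most
-- q^q p^a for each of the fewer than 2^q smaller primes.

module Submission where

open import Defs
open import Data.Integer as ℤ using (ℤ)
import Data.Integer.Properties as ℤ
open import Data.Integer.Divisibility.Signed as ℤ∣ using () renaming (_∣_ to _∣ℤ_)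
open import Data.Integer.Tactic.RingSolver using (solve-∀)
open import Data.List using (List; []; _∷_; _++_; map; upTo; concatMap; filter; length)
open import Data.List.Membership.Propositional using (_∈_)
open import Data.List.Membership.Propositional.Properties using (∈-map⁻; ∈-upTo⁻)
open import Data.List.Properties
  using (filter-++; length-++; concatMap-++; concatMap-pure; concatMap-map; applyUpTo-∷ʳ; ++-identityʳ)
open import Data.List.Relation.Unary.Any using (here; there)
open import Data.Nat
  using (ℕ; zero; suc; pred; _+_; _*_; _^_; _∸_; _≤_; _<_; z≤n; s≤s; s≤s⁻¹; _<?_; _≟_;
         NonZero; >-nonZero; >-nonZero⁻¹; ≢-nonZero; ≢-nonZero⁻¹;
         NonTrivial; nonTrivial⇒n>1; nonTrivial⇒nonZero; n>1⇒nonTrivial)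
open import Data.Nat.Coprimality using (Coprime; coprime-divisor; coprime-/gcd)
open import Data.Nat.Divisibility
  using (_∣_; divides; _∣?_; ∣-refl; ∣⇒≤; n∣m*n; ∣m⇒∣m*n; ∣m+n∣m⇒∣n; *-cancelʳ-∣; m∣n*o⇒m/n∣o;
         quotient; quotient≢0; quotient-<; m∣n⇒n≡m*quotient)
open import Data.Nat.DivMod
  using (_/_; _%_; %-congʳ; n%1≡0; m≡m%n+[m/n]*n; m%n<n; m<n*o⇒m/o<n; +-distrib-/-∣ʳ;
         m*[n/m]≡n; m*n/n≡m; m/n*n≡m; m/n*n≤m; m≥n⇒m/n>0; m/n≤m; /-monoˡ-≤)
open import Data.Nat.GCD using (gcd; gcd[m,n]∣m; gcd[m,n]∣n; gcd[m,n]≢0; gcd-greatest)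
open import Data.Nat.Induction using (<-wellFounded)
open import Data.Nat.Primality
  using (Prime; prime⇒irreducible; prime⇒nonZero; prime⇒nonTrivial;
         _Rough_; 2-rough; rough⇒≤; ∤⇒rough-suc; rough∧∣⇒rough; rough∧∣⇒prime)
open import Data.Nat.Properties
open import Algebra.Properties.CommutativeSemigroup *-commutativeSemigroup
  using (xy∙z≈xz∙y) renaming (interchange to *-interchange)
open import Algebra.Properties.CommutativeSemigroup +-commutativeSemigroup
  using () renaming (interchange to +-interchange)
import Data.Nat.Tactic.RingSolver as ℕ-RingSolver
open import Data.Product using (Σ; ∃; ∃₂; _×_; _,_; proj₁; proj₂; map₂)
open import Data.Rational as ℚ using (toℚᵘ; floor)
import Data.Rational.Properties as ℚ
open import Data.Rational.Unnormalised as ℚᵘ using (mkℚᵘ; *≡*; ↥_; ↧_) renaming (_≃_ to _≃ᵘ_)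
import Data.Rational.Unnormalised.Properties as ℚᵘ
open import Data.Sum using (_⊎_; inj₁; inj₂; [_,_]; map₁)
open import Data.Unit using (tt)
open import Function using (_∘_)
open import Induction.WellFounded using (Acc; acc)
open import Level using (0ℓ)
open import Relation.Binary.PropositionalEquality
  using (_≡_; refl; sym; trans; cong; cong₂; subst; subst₂; module ≡-Reasoning)
open import Relation.Nullary using (Dec; yes; no; ¬_; contradiction)
open import Relation.Nullary.Decidable using (_×-dec_; ¬?)
open import Relation.Unary using (Pred; Decidable)

-- Sums and counts over initial segments of ℕ

∑ : ℕ → (ℕ → ℕ) → ℕ
∑ zero    f = 0
∑ (suc n) f = ∑ n f + f n

syntax ∑ n (λ i → e) = ∑[ i < n ] e

private variable
  n k : ℕ
  f g : ℕ → ℕ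
  P Q R : Pred ℕ 0ℓ

∑-cong : ∀ n → (∀ {i} → i < n → f i ≡ g i) → ∑ n f ≡ ∑ n g
∑-cong zero    _  = refl
∑-cong (suc n) eq = cong₂ _+_ (∑-cong n (eq ∘ m<n⇒m<1+n)) (eq (n<1+n n))

∑-mono-≤ : ∀ n → (∀ {i} → i < n → f i ≤ g i) → ∑ n f ≤ ∑ n g
∑-mono-≤ zero    _  = z≤n
∑-mono-≤ (suc n) le = +-mono-≤ (∑-mono-≤ n (le ∘ m<n⇒m<1+n)) (le (n<1+n n))

f≤∑ : ∀ {i} → i < n → f i ≤ ∑ n f
f≤∑ {suc n} {f} {i} i<1+n with m<1+n⇒m<n∨m≡n i<1+n
... | inj₁ i<n  = ≤-trans (f≤∑ i<n) (m≤m+n (∑ n f) (f n))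
... | inj₂ refl = m≤n+m (f n) (∑ n f)

∑-const : ∀ n c → ∑[ i < n ] c ≡ n * c
∑-const zero    c = refl
∑-const (suc n) c = trans (cong (_+ c) (∑-const n c)) (+-comm (n * c) c)

∑-distrib-+ : ∀ n (f g : ℕ → ℕ) → ∑[ i < n ] (f i + g i) ≡ ∑ n f + ∑ n g
∑-distrib-+ zero    f g = refl
∑-distrib-+ (suc n) f g =
  trans (cong (_+ (f n + g n)) (∑-distrib-+ n f g)) (+-interchange (∑ n f) (∑ n g) (f n) (g n))

∑-*ˡ : ∀ n c (f : ℕ → ℕ) → c * ∑ n f ≡ ∑[ i < n ] (c * f i)
∑-*ˡ zero    c f = *-zeroʳ c
∑-*ˡ (suc n) c f = trans (*-distribˡ-+ c (∑ n f) (f n)) (cong (_+ c * f n) (∑-*ˡ n c f))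

∑-comm : ∀ n k (f : ℕ → ℕ → ℕ) → ∑[ i < n ] ∑[ j < k ] f i j ≡ ∑[ j < k ] ∑[ i < n ] f i j
∑-comm zero    k f = sym (trans (∑-const k 0) (*-zeroʳ k))
∑-comm (suc n) k f = begin
  ∑[ i < n ] ∑[ j < k ] f i j + ∑[ j < k ] f n j   ≡⟨ cong (_+ ∑[ j < k ] f n j) (∑-comm n k f) ⟩
  ∑[ j < k ] ∑[ i < n ] f i j + ∑[ j < k ] f n j   ≡⟨ sym (∑-distrib-+ k (λ j → ∑[ i < n ] f i j) (f n)) ⟩
  ∑[ j < k ] (∑[ i < n ] f i j + f n j)           ∎
  where open ≡-Reasoning

∑-vanishing-from : ∀ {m n} → m ≤ n → (∀ {i} → m ≤ i → f i ≡ 0) → ∑ n f ≡ ∑ m f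
∑-vanishing-from {f = f} {m} {zero}  z≤n _ = refl
∑-vanishing-from {f = f} {m} {suc n} m≤1+n zero-from with m≤n⇒m<n∨m≡n m≤1+n
... | inj₂ refl = refl
... | inj₁ m≤n  = begin
  ∑ n f + f n ≡⟨ cong (∑ n f +_) (zero-from (s≤s⁻¹ m≤n)) ⟩
  ∑ n f + 0   ≡⟨ +-identityʳ (∑ n f) ⟩
  ∑ n f       ≡⟨ ∑-vanishing-from (s≤s⁻¹ m≤n) zero-from ⟩
  ∑ m f       ∎
  where open ≡-Reasoning

𝟙 : {P : Set} → Dec P → ℕ
𝟙 (yes _) = 1
𝟙 (no _)  = 0

𝟙-yes : {P : Set} (P? : Dec P) → P → 𝟙 P? ≡ 1
𝟙-yes (yes _) _ = refl
𝟙-yes (no ¬p) p = contradiction p ¬p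

𝟙-no : {P : Set} (P? : Dec P) → ¬ P → 𝟙 P? ≡ 0
𝟙-no (yes p) ¬p = contradiction p ¬p
𝟙-no (no _)  _  = refl

𝟙-≤ : {P : Set} (P? : Dec P) → (P → 1 ≤ n) → 𝟙 P? ≤ n
𝟙-≤ (yes p) 1≤n = 1≤n p
𝟙-≤ (no _)  _   = z≤n

count : ∀ n {P : Pred ℕ 0ℓ} → Decidable P → ℕ
count n P? = ∑[ i < n ] 𝟙 (P? i)

count≡0 : ∀ n (P? : Decidable P) → (∀ {i} → i < n → ¬ P i) → count n P? ≡ 0
count≡0 zero    P? _  = refl
count≡0 (suc n) P? ¬P with P? n
... | yes p = contradiction p (¬P (n<1+n n))
... | no _  = trans (+-identityʳ _) (count≡0 n P? (¬P ∘ m<n⇒m<1+n))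

count≤1 : ∀ n (P? : Decidable P) →
          (∀ {i j} → i < n → j < n → P i → P j → i ≡ j) → count n P? ≤ 1
count≤1 zero    P? _      = z≤n
count≤1 (suc n) P? unique with P? n
... | no _  = ≤-trans (≤-reflexive (+-identityʳ _))
                (count≤1 n P? (λ i<n j<n → unique (m<n⇒m<1+n i<n) (m<n⇒m<1+n j<n)))
... | yes p = ≤-reflexive (cong (_+ 1) (count≡0 n P? (λ i<n pi →
                <-irrefl (unique (m<n⇒m<1+n i<n) (n<1+n n) pi p) i<n)))

count-≤-inhabited : ∀ n (P? : Decidable P) →
                    (∀ {i} → i < n → P i → count n P? ≤ k) → count n P? ≤ k
count-≤-inhabited zero    P? _     = z≤n
count-≤-inhabited (suc n) P? bound with P? n
... | yes p = bound (n<1+n n) p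
... | no _  = ≤-trans (≤-reflexive (+-identityʳ _)) (count-≤-inhabited n P? (λ i<n pi →
                ≤-trans (≤-reflexive (sym (+-identityʳ _))) (bound (m<n⇒m<1+n i<n) pi)))

count-≤-⊎ : ∀ n (P? : Decidable P) (Q? : Decidable Q) (R? : Decidable R) →
            (∀ {i} → i < n → P i → Q i ⊎ R i) → count n P? ≤ count n Q? + count n R?
count-≤-⊎ {Q = Q} {R = R} n P? Q? R? split = begin
  count n P?                         ≤⟨ ∑-mono-≤ n (λ i<n → 𝟙-≤ (P? _) (λ p → [ via-Q , via-R ] (split i<n p))) ⟩
  ∑[ i < n ] (𝟙 (Q? i) + 𝟙 (R? i))  ≡⟨ ∑-distrib-+ n _ _ ⟩
  count n Q? + count n R?            ∎
  where
    open ≤-Reasoning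
    via-Q : ∀ {i} → Q i → 1 ≤ 𝟙 (Q? i) + 𝟙 (R? i)
    via-Q {i} q = ≤-trans (≤-reflexive (sym (𝟙-yes (Q? i) q))) (m≤m+n _ _)
    via-R : ∀ {i} → R i → 1 ≤ 𝟙 (Q? i) + 𝟙 (R? i)
    via-R {i} r = ≤-trans (≤-reflexive (sym (𝟙-yes (R? i) r))) (m≤n+m _ _)

count-≤-injection : ∀ n (P? : Decidable P) (Q? : Decidable Q) (f : ℕ → ℕ) →
  (∀ {i} → i < n → P i → f i < k × Q (f i)) →
  (∀ {i j} → i < n → j < n → P i → P j → f i ≡ f j → i ≡ j) →
  count n P? ≤ count k Q?
count-≤-injection {P = P} {Q = Q} {k = k} n P? Q? f into injective = begin
  count n P?                                    ≤⟨ ∑-mono-≤ n (λ i<n → 𝟙-≤ (P? _) (hit i<n)) ⟩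
  ∑[ i < n ] ∑[ j < k ] 𝟙 (fiber? j i)          ≡⟨ ∑-comm n k (λ i j → 𝟙 (fiber? j i)) ⟩
  ∑[ j < k ] count n (fiber? j)                 ≤⟨ ∑-mono-≤ k (λ {j} _ → fiber-≤ j (Q? j)) ⟩
  count k Q?                                    ∎
  where
    open ≤-Reasoning
    fiber? : ∀ j → Decidable (λ i → P i × f i ≡ j)
    fiber? j i = P? i ×-dec (f i ≟ j)
    hit : ∀ {i} → i < n → P i → 1 ≤ ∑[ j < k ] 𝟙 (fiber? j i)
    hit {i} i<n p = ≤-trans (≤-reflexive (sym (𝟙-yes (fiber? (f i) i) (p , refl))))
                            (f≤∑ {f = λ j → 𝟙 (fiber? j i)} (proj₁ (into i<n p)))
    fiber-≤ : ∀ j → (Q? : Dec (Q j)) → count n (fiber? j) ≤ 𝟙 Q?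
    fiber-≤ j (yes _) = count≤1 n (fiber? j)
      (λ i<n i′<n (p , fi≡j) (p′ , fi′≡j) → injective i<n i′<n p p′ (trans fi≡j (sym fi′≡j)))
    fiber-≤ j (no ¬q) = ≤-reflexive (count≡0 n (fiber? j)
      (λ i<n (p , fi≡j) → ¬q (subst Q fi≡j (proj₂ (into i<n p)))))

count-≤-injection-into : ∀ n (P? : Decidable P) (f : ℕ → ℕ) → (∀ {i} → i < n → P i → f i < k) →
  (∀ {i j} → i < n → j < n → P i → P j → f i ≡ f j → i ≡ j) → count n P? ≤ k
count-≤-injection-into {k = k} n P? f into injective = begin
  count n P?                ≤⟨ count-≤-injection n P? (λ _ → yes tt) f (λ i<n p → into i<n p , tt) injective ⟩
  count k (λ _ → yes tt)    ≡⟨ trans (∑-const k 1) (*-identityʳ k) ⟩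
  k                         ∎
  where open ≤-Reasoning

count-≤-window : ∀ n (P? : Decidable P) (a s g : ℕ) .{{_ : NonZero s}} →
  (∀ {i} → i < n → P i → a ≤ i × i < a + s * g) →
  (∀ {i j} → i < n → j < n → P i → P j → i ≤ j → s ∣ j ∸ i) →
  count n P? ≤ g
count-≤-window {P = P} n P? a s g window congruent =
  count-≤-injection-into n P? block into injective
  where
    block : ℕ → ℕ
    block i = (i ∸ a) / s
    into : ∀ {i} → i < n → P i → block i < g
    into {i} i<n p with a≤i , i<a+sg ← window i<n p =
      m<n*o⇒m/o<n (subst (i ∸ a <_) (trans (m+n∸m≡n a (s * g)) (*-comm s g)) (∸-monoˡ-< i<a+sg a≤i))
    same-block⇒≡ : ∀ {i j} → i < n → j < n → P i → P j → i ≤ j → block i ≡ block j → i ≡ j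
    same-block⇒≡ {i} {j} i<n j<n pi pj i≤j same = begin
      i               ≡⟨ sym (+-identityʳ i) ⟩
      i + 0           ≡⟨ cong (i +_) (sym d≡0) ⟩
      i + (j ∸ i)     ≡⟨ m+[n∸m]≡n i≤j ⟩
      j               ∎
      where
        open ≡-Reasoning
        d = j ∸ i
        s∣d : s ∣ d
        s∣d = congruent i<n j<n pi pj i≤j
        j∸a≡i∸a+d : j ∸ a ≡ (i ∸ a) + d
        j∸a≡i∸a+d = trans (cong (_∸ a) (sym (m+[n∸m]≡n i≤j))) (+-∸-comm d (proj₁ (window i<n pi)))
        d/s≡0 : d / s ≡ 0
        d/s≡0 = +-cancelˡ-≡ (block i) (d / s) 0 (begin
          block i + d / s      ≡⟨ sym (+-distrib-/-∣ʳ (i ∸ a) s∣d) ⟩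
          ((i ∸ a) + d) / s    ≡⟨ cong (_/ s) (sym j∸a≡i∸a+d) ⟩
          block j              ≡⟨ sym same ⟩
          block i              ≡⟨ sym (+-identityʳ (block i)) ⟩
          block i + 0          ∎)
        d≡0 : d ≡ 0
        d≡0 = trans (sym (m*[n/m]≡n s∣d)) (trans (cong (s *_) d/s≡0) (*-zeroʳ s))
    injective : ∀ {i j} → i < n → j < n → P i → P j → block i ≡ block j → i ≡ j
    injective i<n j<n pi pj same with ≤-total _ _
    ... | inj₁ i≤j = same-block⇒≡ i<n j<n pi pj i≤j same
    ... | inj₂ j≤i = sym (same-block⇒≡ j<n i<n pj pi j≤i (sym same))

-- The divisor bound

-- Candidate divisors range over [0, n]; 0 divides no n ≠ 0 (τ 0 = 1 is junk).
τ : ℕ → ℕ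
τ n = count (suc n) (_∣? n)

τ[p*k]≤τ[n]+τ[k] : ∀ p k n .{{_ : NonZero p}} .{{_ : NonZero k}} .{{_ : NonZero n}} →
                   (∀ {d} → d ∣ p * k → ¬ p ∣ d → d ∣ n) → τ (p * k) ≤ τ n + τ k
τ[p*k]≤τ[n]+τ[k] p k n coprime-part∣n = begin
  τ (p * k)
    ≤⟨ count-≤-⊎ (suc (p * k)) (_∣? p * k) coprime? multiple? (λ {d} _ d∣pk → by-p∣d d∣pk (p ∣? d)) ⟩
  count (suc (p * k)) coprime? + count (suc (p * k)) multiple?
    ≤⟨ +-mono-≤ coprime-part multiple-part ⟩
  τ n + τ k                                  ∎
  where
    open ≤-Reasoning
    instance _ = m*n≢0 p k
    coprime? : Decidable (λ d → d ∣ p * k × ¬ p ∣ d)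
    coprime? d = (d ∣? p * k) ×-dec ¬? (p ∣? d)
    multiple? : Decidable (λ d → d ∣ p * k × p ∣ d)
    multiple? d = (d ∣? p * k) ×-dec (p ∣? d)
    by-p∣d : ∀ {d} → d ∣ p * k → Dec (p ∣ d) → (d ∣ p * k × ¬ p ∣ d) ⊎ (d ∣ p * k × p ∣ d)
    by-p∣d d∣pk (yes p∣d) = inj₂ (d∣pk , p∣d)
    by-p∣d d∣pk (no p∤d)  = inj₁ (d∣pk , p∤d)
    coprime-part : count (suc (p * k)) coprime? ≤ τ n
    coprime-part = count-≤-injection (suc (p * k)) coprime? (_∣? n) (λ d → d)
      (λ _ (d∣pk , p∤d) → let d∣n = coprime-part∣n d∣pk p∤d in s≤s (∣⇒≤ d∣n) , d∣n)
      (λ _ _ _ _ d≡d′ → d≡d′)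
    multiple-part : count (suc (p * k)) multiple? ≤ τ k
    multiple-part = count-≤-injection (suc (p * k)) multiple? (_∣? k) (_/ p)
      (λ {d} _ (d∣pk , p∣d) →
         s≤s (subst (d / p ≤_) (m*n/n≡m k p) (/-monoˡ-≤ p (subst (d ≤_) (*-comm p k) (∣⇒≤ d∣pk)))) ,
         m∣n*o⇒m/n∣o p∣d (subst (d ∣_) (*-comm p k) d∣pk))
      (λ {d} {d′} _ _ (_ , p∣d) (_ , p∣d′) d/p≡d′/p →
         trans (sym (m*[n/m]≡n p∣d)) (trans (cong (p *_) d/p≡d′/p) (m*[n/m]≡n p∣d′)))

prime∤⇒coprime : ∀ {p d} → Prime p → ¬ p ∣ d → Coprime d p
prime∤⇒coprime p-prime p∤d (i∣d , i∣p) with prime⇒irreducible p-prime i∣p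
... | inj₁ i≡1    = i≡1
... | inj₂ refl   = contradiction i∣d p∤d

coprime-divisor-^ : ∀ {d p} a {n} → Coprime d p → d ∣ p ^ a * n → d ∣ n
coprime-divisor-^ {d} {p} zero    {n} _     d∣n   = subst (d ∣_) (*-identityˡ n) d∣n
coprime-divisor-^ {d} {p} (suc a) {n} d⊥p d∣pᵃ⁺¹n =
  coprime-divisor-^ a d⊥p (coprime-divisor d⊥p (subst (d ∣_) (*-assoc p (p ^ a) n) d∣pᵃ⁺¹n))

τ[pᵃ*n]≤[1+a]*τ[n] : ∀ {p n} → Prime p → ¬ p ∣ n → .{{_ : NonZero n}} →
                     ∀ a → τ (p ^ a * n) ≤ suc a * τ n
τ[pᵃ*n]≤[1+a]*τ[n] {p} {n} p-prime p∤n zero =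
  ≤-reflexive (trans (cong τ (*-identityˡ n)) (sym (+-identityʳ (τ n))))
τ[pᵃ*n]≤[1+a]*τ[n] {p} {n} p-prime p∤n (suc a) = begin
  τ (p ^ suc a * n)      ≡⟨ cong τ (*-assoc p (p ^ a) n) ⟩
  τ (p * (p ^ a * n))    ≤⟨ τ[p*k]≤τ[n]+τ[k] p (p ^ a * n) n p∤d⇒d∣n ⟩
  τ n + τ (p ^ a * n)    ≤⟨ +-monoʳ-≤ (τ n) (τ[pᵃ*n]≤[1+a]*τ[n] p-prime p∤n a) ⟩
  τ n + suc a * τ n      ∎
  where
    open ≤-Reasoning
    instance
      _ = prime⇒nonZero p-prime
      _ = m*n≢0 (p ^ a) n {{m^n≢0 p a}}
    p∤d⇒d∣n : ∀ {d} → d ∣ p * (p ^ a * n) → ¬ p ∣ d → d ∣ n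
    p∤d⇒d∣n {d} d∣ p∤d =
      coprime-divisor-^ (suc a) (prime∤⇒coprime p-prime p∤d) (subst (d ∣_) (sym (*-assoc p (p ^ a) n)) d∣)

least-divisor-from : ∀ {L n} .{{_ : NonTrivial n}} → L Rough n → ∃ λ p → L ≤ p × p ∣ n × p Rough n
least-divisor-from {L} {n} L-rough = search (n ∸ L) refl ≤-refl L-rough
  where
    search : ∀ k {m} → n ∸ m ≡ k → L ≤ m → m Rough n → ∃ λ p → L ≤ p × p ∣ n × p Rough n
    search k {m} _ L≤m m-rough with m ∣? n
    ... | yes m∣n = m , L≤m , m∣n , m-rough
    search zero    {m} n∸m≡0 L≤m m-rough | no m∤n =
      contradiction (subst (_∣ n) (≤-antisym (m∸n≡0⇒m≤n n∸m≡0) (rough⇒≤ m-rough)) ∣-refl) m∤n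
    search (suc k) {m} n∸m≡1+k L≤m m-rough | no m∤n =
      search k (trans (sym (pred[m∸n]≡m∸[1+n] n m)) (cong pred n∸m≡1+k))
               (m≤n⇒m≤1+n L≤m) (∤⇒rough-suc m∤n m-rough)

p-adic-decomposition : ∀ p n .{{_ : NonTrivial p}} .{{_ : NonZero n}} →
                       ∃₂ λ a n′ → n ≡ p ^ a * n′ × ¬ p ∣ n′
p-adic-decomposition p n = go n (<-wellFounded n)
  where
    go : ∀ n .{{_ : NonZero n}} → Acc _<_ n → ∃₂ λ a n′ → n ≡ p ^ a * n′ × ¬ p ∣ n′
    go n (acc smaller) with p ∣? n
    ... | no p∤n = 0 , n , sym (*-identityˡ n) , p∤n
    ... | yes p∣n
      with a , n′ , q≡pᵃn′ , p∤n′ ← go (quotient p∣n) {{quotient≢0 p∣n}} (smaller (quotient-< p∣n)) =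
      suc a , n′ , trans (m∣n⇒n≡m*quotient p∣n) (trans (cong (p *_) q≡pᵃn′) (sym (*-assoc p (p ^ a) n′))) , p∤n′

^-distribʳ-* : ∀ m n o → (m * n) ^ o ≡ m ^ o * n ^ o
^-distribʳ-* m n zero    = refl
^-distribʳ-* m n (suc o) = trans (cong ((m * n) *_) (^-distribʳ-* m n o)) (*-interchange m n (m ^ o) (n ^ o))

1+n≤2^n : ∀ n → suc n ≤ 2 ^ n
1+n≤2^n zero    = ≤-refl
1+n≤2^n (suc n) = begin
  1 + suc n          ≤⟨ +-mono-≤ (m^n>0 2 n) (1+n≤2^n n) ⟩
  2 ^ n + 2 ^ n      ≡⟨ cong (2 ^ n +_) (sym (+-identityʳ (2 ^ n))) ⟩
  2 ^ suc n          ∎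
  where open ≤-Reasoning

module _ (q : ℕ) .{{_ : NonZero q}} where

  private
    K T : ℕ
    K = q ^ q
    T = 2 ^ q
    instance _ = m^n≢0 q q

  [1+a]^q≤K*2^a : ∀ a → suc a ^ q ≤ K * 2 ^ a
  [1+a]^q≤K*2^a a = begin
    suc a ^ q                  ≤⟨ ^-monoˡ-≤ q 1+a≤q*2^s ⟩
    (q * 2 ^ s) ^ q            ≡⟨ ^-distribʳ-* q (2 ^ s) q ⟩
    q ^ q * (2 ^ s) ^ q        ≡⟨ cong (q ^ q *_) (^-*-assoc 2 s q) ⟩
    q ^ q * 2 ^ (s * q)        ≤⟨ *-monoʳ-≤ (q ^ q) (^-monoʳ-≤ 2 sq≤a) ⟩
    q ^ q * 2 ^ a              ∎
    where
      open ≤-Reasoning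
      s = a / q
      a≡r+sq : a ≡ a % q + s * q
      a≡r+sq = m≡m%n+[m/n]*n a q
      sq≤a : s * q ≤ a
      sq≤a = subst (s * q ≤_) (sym a≡r+sq) (m≤n+m (s * q) (a % q))
      1+a≤q*2^s : suc a ≤ q * 2 ^ s
      1+a≤q*2^s = begin
        suc a              ≡⟨ cong suc a≡r+sq ⟩
        suc (a % q) + s * q ≤⟨ +-monoˡ-≤ (s * q) (m%n<n a q) ⟩
        suc s * q          ≤⟨ *-monoˡ-≤ q (1+n≤2^n s) ⟩
        2 ^ s * q          ≡⟨ *-comm (2 ^ s) q ⟩
        q * 2 ^ s          ∎

  [1+a]^q≤p^a : ∀ {p} a → 2 ^ q ≤ p → suc a ^ q ≤ p ^ a
  [1+a]^q≤p^a {p} a 2^q≤p = begin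
    suc a ^ q          ≤⟨ ^-monoˡ-≤ q (1+n≤2^n a) ⟩
    (2 ^ a) ^ q        ≡⟨ ^-*-assoc 2 a q ⟩
    2 ^ (a * q)        ≡⟨ cong (2 ^_) (*-comm a q) ⟩
    2 ^ (q * a)        ≡⟨ sym (^-*-assoc 2 q a) ⟩
    (2 ^ q) ^ a        ≤⟨ ^-monoˡ-≤ a 2^q≤p ⟩
    p ^ a              ∎
    where open ≤-Reasoning

  prime-power-weight : ∀ {p} a → 2 ≤ p → suc a ^ q * K ^ (T ∸ suc p) ≤ K ^ (T ∸ p) * p ^ a
  prime-power-weight {p} a 2≤p with p <? 2 ^ q
  ... | yes p<2^q = begin
    suc a ^ q * K ^ (T ∸ suc p)          ≤⟨ *-monoˡ-≤ (K ^ (T ∸ suc p)) ([1+a]^q≤K*2^a a) ⟩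
    (K * 2 ^ a) * K ^ (T ∸ suc p)        ≤⟨ *-monoˡ-≤ (K ^ (T ∸ suc p)) (*-monoʳ-≤ K (^-monoˡ-≤ a 2≤p)) ⟩
    (K * p ^ a) * K ^ (T ∸ suc p)        ≡⟨ xy∙z≈xz∙y K (p ^ a) (K ^ (T ∸ suc p)) ⟩
    K ^ suc (T ∸ suc p) * p ^ a          ≡⟨ cong (λ e → K ^ e * p ^ a) T∸p≡1+T∸[1+p] ⟩
    K ^ (T ∸ p) * p ^ a                  ∎
    where
      open ≤-Reasoning
      T∸p≡1+T∸[1+p] : suc (T ∸ suc p) ≡ T ∸ p
      T∸p≡1+T∸[1+p] =
        trans (cong suc (sym (pred[m∸n]≡m∸[1+n] T p))) (suc-pred (T ∸ p) {{>-nonZero (m<n⇒0<n∸m p<2^q)}})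
  ... | no p≮2^q = begin
    suc a ^ q * K ^ (T ∸ suc p)          ≡⟨ cong (λ e → suc a ^ q * K ^ e) (m≤n⇒m∸n≡0 (m≤n⇒m≤1+n 2^q≤p)) ⟩
    suc a ^ q * 1                        ≡⟨ *-identityʳ (suc a ^ q) ⟩
    suc a ^ q                            ≤⟨ [1+a]^q≤p^a a 2^q≤p ⟩
    p ^ a                                ≡⟨ sym (*-identityˡ (p ^ a)) ⟩
    1 * p ^ a                            ≡⟨ cong (λ e → K ^ e * p ^ a) (sym (m≤n⇒m∸n≡0 2^q≤p)) ⟩
    K ^ (T ∸ p) * p ^ a                  ∎
    where
      open ≤-Reasoning
      2^q≤p = ≮⇒≥ p≮2^q

  τ^q≤-prime-power-step : ∀ {p n L} a → Prime p → ¬ p ∣ n → .{{_ : NonZero n}} → L ≤ p →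
    τ n ^ q ≤ K ^ (T ∸ suc p) * n → τ (p ^ a * n) ^ q ≤ K ^ (T ∸ L) * (p ^ a * n)
  τ^q≤-prime-power-step {p} {n} {L} a p-prime p∤n L≤p τ^q≤ = begin
    τ (p ^ a * n) ^ q                       ≤⟨ ^-monoˡ-≤ q (τ[pᵃ*n]≤[1+a]*τ[n] p-prime p∤n a) ⟩
    (suc a * τ n) ^ q                       ≡⟨ ^-distribʳ-* (suc a) (τ n) q ⟩
    suc a ^ q * τ n ^ q                     ≤⟨ *-monoʳ-≤ (suc a ^ q) τ^q≤ ⟩
    suc a ^ q * (K ^ (T ∸ suc p) * n)       ≡⟨ sym (*-assoc (suc a ^ q) (K ^ (T ∸ suc p)) n) ⟩
    (suc a ^ q * K ^ (T ∸ suc p)) * n       ≤⟨ *-monoˡ-≤ n (prime-power-weight a 2≤p) ⟩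
    (K ^ (T ∸ p) * p ^ a) * n               ≤⟨ *-monoˡ-≤ n (*-monoˡ-≤ (p ^ a) (^-monoʳ-≤ K (∸-monoʳ-≤ T L≤p))) ⟩
    (K ^ (T ∸ L) * p ^ a) * n               ≡⟨ *-assoc (K ^ (T ∸ L)) (p ^ a) n ⟩
    K ^ (T ∸ L) * (p ^ a * n)               ∎
    where
      open ≤-Reasoning
      2≤p = nonTrivial⇒n>1 p {{prime⇒nonTrivial p-prime}}

  -- K ^ (T ∸ L) pays a factor K for each of the primes in [L, T).
  τ^q≤-rough : ∀ {L} n .{{_ : NonZero n}} → 2 ≤ L → L Rough n → τ n ^ q ≤ K ^ (T ∸ L) * n
  τ^q≤-rough n = go n (<-wellFounded n)
    where
      go : ∀ {L} n .{{_ : NonZero n}} → Acc _<_ n → 2 ≤ L → L Rough n → τ n ^ q ≤ K ^ (T ∸ L) * n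
      go {L} 1 _ _ _ = begin
        τ 1 ^ q            ≡⟨ ^-zeroˡ q ⟩
        1                  ≤⟨ m^n>0 K (T ∸ L) ⟩
        K ^ (T ∸ L)        ≡⟨ sym (*-identityʳ (K ^ (T ∸ L))) ⟩
        K ^ (T ∸ L) * 1    ∎
        where open ≤-Reasoning
      go {L} n@(suc (suc _)) (acc smaller) 2≤L L-rough with least-divisor-from L-rough
      ... | p , L≤p , p∣n , p-rough with p-adic-decomposition p n {{n>1⇒nonTrivial (≤-trans 2≤L L≤p)}}
      ... | zero , n′ , n≡pᵃn′ , p∤n′ =
        contradiction (subst (p ∣_) (trans n≡pᵃn′ (*-identityˡ n′)) p∣n) p∤n′
      ... | suc a , n′ , n≡pᵃn′ , p∤n′ =
        subst (λ k → τ k ^ q ≤ K ^ (T ∸ L) * k) (sym n≡pᵃn′)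
              (τ^q≤-prime-power-step (suc a) p-prime p∤n′ L≤p τ[n′]^q≤)
        where
          instance
            _ = n>1⇒nonTrivial {p} (≤-trans 2≤L L≤p)
            _ = nonTrivial⇒nonZero p
            _ = m^n≢0 p a
            _ = m*n≢0⇒n≢0 (p ^ suc a) {{subst NonZero n≡pᵃn′ _}}
          p-prime : Prime p
          p-prime = rough∧∣⇒prime p-rough p∣n
          n′∣n : n′ ∣ n
          n′∣n = subst (n′ ∣_) (sym n≡pᵃn′) (n∣m*n (p ^ suc a))
          n′<n : n′ < n
          n′<n = begin-strict
            n′                 <⟨ m<m*n n′ (p ^ suc a) (<-≤-trans (nonTrivial⇒n>1 p) (m≤m*n p (p ^ a))) ⟩
            n′ * p ^ suc a     ≡⟨ *-comm n′ (p ^ suc a) ⟩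
            p ^ suc a * n′     ≡⟨ sym n≡pᵃn′ ⟩
            n                  ∎
            where open ≤-Reasoning
          τ[n′]^q≤ : τ n′ ^ q ≤ K ^ (T ∸ suc p) * n′
          τ[n′]^q≤ = go n′ (smaller n′<n) (m≤n⇒m≤1+n (≤-trans 2≤L L≤p))
                        (∤⇒rough-suc p∤n′ (rough∧∣⇒rough p-rough n′∣n))

  τ^q≤ : ∀ n .{{_ : NonZero n}} → τ n ^ q ≤ (q ^ q) ^ (2 ^ q) * n
  τ^q≤ n = ≤-trans (τ^q≤-rough n ≤-refl 2-rough) (*-monoˡ-≤ n (^-monoʳ-≤ K (m∸n≤m T 2)))

1≤τ : ∀ n .{{_ : NonZero n}} → 1 ≤ τ n
1≤τ n = ≤-trans (≤-reflexive (sym (𝟙-yes (n ∣? n) ∣-refl))) (f≤∑ {f = λ d → 𝟙 (d ∣? n)} (n<1+n n))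

-- Divisibility and congruences

*≤⇒≤/ : ∀ {r x N} .{{_ : NonZero r}} → r * x ≤ N → x ≤ N / r
*≤⇒≤/ {r} {x} {N} rx≤N = subst (_≤ N / r) (m*n/n≡m x r) (/-monoˡ-≤ r (subst (_≤ N) (*-comm r x) rx≤N))

%≡%⇒∣∸ : ∀ {m n d} .{{_ : NonZero d}} → m % d ≡ n % d → m ≤ n → d ∣ n ∸ m
%≡%⇒∣∸ {m} {n} {d} m%d≡n%d _ = divides (n / d ∸ m / d) (begin
  n ∸ m                                        ≡⟨ cong₂ _∸_ (m≡m%n+[m/n]*n n d) (m≡m%n+[m/n]*n m d) ⟩
  (n % d + n / d * d) ∸ (m % d + m / d * d)    ≡⟨ cong (λ r → (r + n / d * d) ∸ (m % d + m / d * d)) (sym m%d≡n%d) ⟩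
  (m % d + n / d * d) ∸ (m % d + m / d * d)    ≡⟨ [m+n]∸[m+o]≡n∸o (m % d) (n / d * d) (m / d * d) ⟩
  n / d * d ∸ m / d * d                        ≡⟨ sym (*-distribʳ-∸ d (n / d) (m / d)) ⟩
  (n / d ∸ m / d) * d                          ∎)
  where open ≡-Reasoning

gcd-nonZeroˡ : ∀ x N .{{_ : NonZero x}} → NonZero (gcd x N)
gcd-nonZeroˡ x N = ≢-nonZero (gcd[m,n]≢0 x N (inj₁ (≢-nonZero⁻¹ x)))

∣*⇒/gcd∣ : ∀ x N {d} .{{_ : NonZero (gcd x N)}} → x ∣ N * d → x / gcd x N ∣ d
∣*⇒/gcd∣ x N {d} x∣Nd =
  coprime-divisor (coprime-/gcd x N) (*-cancelʳ-∣ γ (subst₂ _∣_ x≡x/γ*γ Nd≡N/γ*d*γ x∣Nd))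
  where
    γ = gcd x N
    x≡x/γ*γ : x ≡ x / γ * γ
    x≡x/γ*γ = sym (m/n*n≡m (gcd[m,n]∣m x N))
    Nd≡N/γ*d*γ : N * d ≡ N / γ * d * γ
    Nd≡N/γ*d*γ = trans (cong (_* d) (sym (m/n*n≡m (gcd[m,n]∣n x N)))) (xy∙z≈xz∙y (N / γ) γ d)

∣ℤ-∸ : ∀ {x m a b} → ℤ.+ x ∣ℤ ℤ.+ m ℤ.- ℤ.+ a → ℤ.+ x ∣ℤ ℤ.+ m ℤ.- ℤ.+ b → a ≤ b → x ∣ b ∸ a
∣ℤ-∸ {x} {m} {a} {b} x∣m-a x∣m-b a≤b =
  ℤ∣.∣⇒∣ᵤ (subst (ℤ.+ x ∣ℤ_) m-a-[m-b]≡b∸a (ℤ∣.∣m∣n⇒∣m-n x∣m-a x∣m-b))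
  where
    m-a-[m-b]≡b∸a : (ℤ.+ m ℤ.- ℤ.+ a) ℤ.- (ℤ.+ m ℤ.- ℤ.+ b) ≡ ℤ.+ (b ∸ a)
    m-a-[m-b]≡b∸a = begin
      (ℤ.+ m ℤ.- ℤ.+ a) ℤ.- (ℤ.+ m ℤ.- ℤ.+ b)  ≡⟨ [m-a]-[m-b]≡b-a (ℤ.+ m) (ℤ.+ a) (ℤ.+ b) ⟩
      ℤ.+ b ℤ.- ℤ.+ a                          ≡⟨ ℤ.[+m]-[+n]≡m⊖n b a ⟩
      b ℤ.⊖ a                                  ≡⟨ ℤ.⊖-≥ a≤b ⟩
      ℤ.+ (b ∸ a)                              ∎
      where
        open ≡-Reasoning
        [m-a]-[m-b]≡b-a : ∀ (m a b : ℤ) → (m ℤ.- a) ℤ.- (m ℤ.- b) ≡ b ℤ.- a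
        [m-a]-[m-b]≡b-a = solve-∀

∣ℤ-common-divisor : ∀ {x m a d} → ℤ.+ x ∣ℤ ℤ.+ m ℤ.- ℤ.+ a → d ∣ x → d ∣ a → d ∣ m
∣ℤ-common-divisor {x} {m} {a} {d} x∣m-a d∣x d∣a = ℤ∣.∣⇒∣ᵤ (subst (ℤ.+ d ∣ℤ_) (m-a+a≡m (ℤ.+ m) (ℤ.+ a))
  (ℤ∣.∣m∣n⇒∣m+n (ℤ∣.∣-trans (ℤ∣.∣ᵤ⇒∣ d∣x) x∣m-a) (ℤ∣.∣ᵤ⇒∣ d∣a)))
  where
    m-a+a≡m : ∀ (m a : ℤ) → (m ℤ.- a) ℤ.+ a ≡ m
    m-a+a≡m = solve-∀

-- Integrality of U

∣∧<⇒≡0 : ∀ {d n} → d ∣ n → n < d → n ≡ 0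
∣∧<⇒≡0 {n = zero}  _   _   = refl
∣∧<⇒≡0 {n = suc n} d∣n n<d = contradiction (∣⇒≤ d∣n) (<⇒≱ n<d)

isInt⇒↧∣↥ : ∀ {q p} → toℚᵘ q ≃ᵘ p → IsInt q → ↧ p ∣ℤ ↥ p
isInt⇒↧∣↥ {q} {p} q≃p isInt
  with ℚᵘ.≃-trans (ℚᵘ.≃-sym (ℚ.toℚᵘ-fromℚᵘ (mkℚᵘ (floor q) 0))) (ℚᵘ.≃-trans (ℚ.toℚᵘ-cong isInt) q≃p)
... | *≡* ⌊q⌋*↧p≡↥p*1 = ℤ∣.divides (floor q) (trans (sym (ℤ.*-identityʳ (↥ p))) (sym ⌊q⌋*↧p≡↥p*1))

b0-search-solves : ∀ x y m .{{_ : NonZero y}} bs →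
                   (b0-search x y m bs * x) % y ≡ m % y ⊎ b0-search x y m bs ≡ y
b0-search-solves x y m []       = inj₂ refl
b0-search-solves x y m (b ∷ bs) with (b * x) % y ≟ m % y
... | yes bx≡m = inj₁ bx≡m
... | no _     = b0-search-solves x y m bs

b0-search-∈ : ∀ x y m .{{_ : NonZero y}} bs → b0-search x y m bs ∈ bs ⊎ b0-search x y m bs ≡ y
b0-search-∈ x y m []       = inj₂ refl
b0-search-∈ x y m (b ∷ bs) with (b * x) % y ≟ m % y
... | yes _ = inj₁ (here refl)
... | no _  = map₁ there (b0-search-∈ x y m bs)

b₀-range : ∀ x y m .{{_ : NonZero y}} → 1 ≤ b₀ x y m × b₀ x y m ≤ y
b₀-range x y m with b0-search-∈ x y m (map suc (upTo y))
... | inj₂ b₀≡y = subst (1 ≤_) (sym b₀≡y) (>-nonZero⁻¹ y) , ≤-reflexive b₀≡y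
... | inj₁ b₀∈ with k , k∈upTo , b₀≡1+k ← ∈-map⁻ suc b₀∈ =
  subst (1 ≤_) (sym b₀≡1+k) (s≤s z≤n) , subst (_≤ y) (sym b₀≡1+k) (∈-upTo⁻ k∈upTo)

b₀≡1⇒≡-mod : ∀ x y m .{{_ : NonZero y}} → b₀ x y m ≡ 1 → x % y ≡ m % y
b₀≡1⇒≡-mod x y m b₀≡1 with b0-search-solves x y m (map suc (upTo y))
... | inj₁ b₀x≡m = begin
  x % y               ≡⟨ cong (_% y) (sym (*-identityˡ x)) ⟩
  (1 * x) % y         ≡⟨ cong (λ b → (b * x) % y) (sym b₀≡1) ⟩
  (b₀ x y m * x) % y  ≡⟨ b₀x≡m ⟩
  m % y               ∎
  where open ≡-Reasoning
... | inj₂ b₀≡y  = begin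
  x % y   ≡⟨ %-congʳ y≡1 ⟩
  x % 1   ≡⟨ n%1≡0 x ⟩
  0       ≡⟨ sym (n%1≡0 m) ⟩
  m % 1   ≡⟨ %-congʳ (sym y≡1) ⟩
  m % y   ∎
  where
    open ≡-Reasoning
    y≡1 = trans (sym b₀≡y) b₀≡1

[1-b]/y-isInt⇒b≡1 : ∀ {b j} → 1 ≤ b → b ≤ suc j → IsInt ((ℤ.1ℤ ℤ.- ℤ.+ b) ℚ./ suc j) → b ≡ 1
[1-b]/y-isInt⇒b≡1 {b} {j} 1≤b b≤y isInt = trans (sym (m∸n+n≡m 1≤b)) (cong (_+ 1) b∸1≡0)
  where
    y∣1-b : ℤ.+ suc j ∣ℤ ℤ.1ℤ ℤ.- ℤ.+ b
    y∣1-b = isInt⇒↧∣↥ (ℚ.toℚᵘ-fromℚᵘ (mkℚᵘ (ℤ.1ℤ ℤ.- ℤ.+ b) j)) isInt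
    ∣1-b∣≡b∸1 : ℤ.∣ ℤ.1ℤ ℤ.- ℤ.+ b ∣ ≡ b ∸ 1
    ∣1-b∣≡b∸1 = trans (cong ℤ.∣_∣ (ℤ.[+m]-[+n]≡m⊖n 1 b)) (ℤ.∣⊖∣-≤ 1≤b)
    b∸1≡0 : b ∸ 1 ≡ 0
    b∸1≡0 = ∣∧<⇒≡0 (subst (suc j ∣_) ∣1-b∣≡b∸1 (ℤ∣.∣⇒∣ᵤ y∣1-b)) (s≤s (∸-monoˡ-≤ 1 b≤y))

[[m-bx]/y-N]/x-isInt⇒x∣m-Ny : ∀ m b N i j →
  IsInt ((((ℤ.+ m ℤ.- ℤ.+ (b * suc i)) ℚ./ suc j) ℚ.- ℕ→ℚ N) ℚ.* (ℤ.1ℤ ℚ./ suc i)) →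
  ℤ.+ suc i ∣ℤ ℤ.+ m ℤ.- ℤ.+ (N * suc j)
[[m-bx]/y-N]/x-isInt⇒x∣m-Ny m b N i j isInt =
  subst (ℤ.+ suc i ∣ℤ_) numerator+bx≡m-Ny (ℤ∣.∣m∣n⇒∣m+n x∣numerator (ℤ∣.∣ᵤ⇒∣ (n∣m*n b)))
  where
    a = ℤ.+ m ℤ.- ℤ.+ (b * suc i)
    -- Unlike its normalised counterpart, this fraction has denominator exactly y x.
    exact = (mkℚᵘ a j ℚᵘ.- mkℚᵘ (ℤ.+ N) 0) ℚᵘ.* mkℚᵘ ℤ.1ℤ i
    exact≃ : toℚᵘ (((a ℚ./ suc j) ℚ.- ℕ→ℚ N) ℚ.* (ℤ.1ℤ ℚ./ suc i)) ≃ᵘ exact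
    exact≃ = ℚᵘ.≃-trans (ℚ.toℚᵘ-homo-* ((a ℚ./ suc j) ℚ.- ℕ→ℚ N) (ℤ.1ℤ ℚ./ suc i))
      (ℚᵘ.*-cong (ℚᵘ.≃-trans (ℚ.toℚᵘ-homo-+ (a ℚ./ suc j) (ℚ.- ℕ→ℚ N))
                    (ℚᵘ.+-cong (ℚ.toℚᵘ-fromℚᵘ (mkℚᵘ a j))
                               (ℚᵘ.≃-trans (ℚ.toℚᵘ-homo‿- (ℕ→ℚ N))
                                           (ℚᵘ.-‿cong (ℚ.toℚᵘ-fromℚᵘ (mkℚᵘ (ℤ.+ N) 0))))))
                 (ℚ.toℚᵘ-fromℚᵘ (mkℚᵘ ℤ.1ℤ i)))
    x∣numerator : ℤ.+ suc i ∣ℤ ↥ exact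
    x∣numerator = ℤ∣.∣-trans (ℤ∣.∣ᵤ⇒∣ (n∣m*n (suc j * 1))) (isInt⇒↧∣↥ exact≃ isInt)
    identity : ∀ (m B N y : ℤ) → ((m ℤ.- B) ℤ.* ℤ.1ℤ ℤ.+ ℤ.- N ℤ.* y) ℤ.* ℤ.1ℤ ℤ.+ B ≡ m ℤ.- N ℤ.* y
    identity = solve-∀
    numerator+bx≡m-Ny : ↥ exact ℤ.+ ℤ.+ (b * suc i) ≡ ℤ.+ m ℤ.- ℤ.+ (N * suc j)
    numerator+bx≡m-Ny = trans (identity (ℤ.+ m) (ℤ.+ (b * suc i)) (ℤ.+ N) (ℤ.+ suc j))
                              (cong (λ t → ℤ.+ m ℤ.- t) (sym (ℤ.pos-* N (suc j))))

isInt-U⇒ : ∀ N m x y .{{_ : NonZero x}} .{{_ : NonZero y}} → IsInt (U N m x y) →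
  x % y ≡ m % y ⊎ ℤ.+ x ∣ℤ ℤ.+ m ℤ.- ℤ.+ (N * y)
isInt-U⇒ N m x@(suc i) y@(suc j) isInt
  with ℚ.⊔-sel ((ℤ.1ℤ ℤ.- ℤ.+ b₀ x y m) ℚ./ y) ((d₀ x y m ℚ.- ℕ→ℚ N) ℚ.* (ℤ.1ℤ ℚ./ x))
... | inj₁ U≡first  = inj₁ (b₀≡1⇒≡-mod x y m
        ([1-b]/y-isInt⇒b≡1 (proj₁ (b₀-range x y m)) (proj₂ (b₀-range x y m)) (subst IsInt U≡first isInt)))
... | inj₂ U≡second = inj₂ ([[m-bx]/y-N]/x-isInt⇒x∣m-Ny m (b₀ x y m) N i j (subst IsInt U≡second isInt))

-- Counting the pairs

∸-window : ∀ {M c i} → i < M → M < c + suc i → M ∸ c ≤ i × i < (M ∸ c) + c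
∸-window {M} {c} {i} i<M M<c+1+i =
  m≤n+o⇒m∸n≤o M c (s≤s⁻¹ (subst (M <_) (+-suc c i) M<c+1+i)) ,
  <-≤-trans i<M (subst (M ≤_) (+-comm c (M ∸ c)) (m≤n+m∸n M c))

count-≡-mod-in-window : ∀ M m y .{{_ : NonZero y}} →
  count M (λ i → (M <? y + suc i) ×-dec (suc i % y ≟ m % y)) ≤ 1
count-≡-mod-in-window M m y = count-≤-window M _ (M ∸ y) y 1 window congruent
  where
    window : ∀ {i} → i < M → M < y + suc i × suc i % y ≡ m % y → M ∸ y ≤ i × i < (M ∸ y) + y * 1
    window {i} i<M (M<y+x , _) = map₂ (subst (i <_) (cong ((M ∸ y) +_) (sym (*-identityʳ y))))
                                      (∸-window i<M M<y+x)
    congruent : ∀ {i j} → i < M → j < M → M < y + suc i × suc i % y ≡ m % y →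
                M < y + suc j × suc j % y ≡ m % y → i ≤ j → y ∣ j ∸ i
    congruent _ _ (_ , x≡m) (_ , x′≡m) i≤j = %≡%⇒∣∸ (trans x≡m (sym x′≡m)) (s≤s i≤j)

count-∣-in-window : ∀ M N m x .{{_ : NonZero x}} →
  count M (λ j → (M <? x + suc j) ×-dec (ℤ.+ x ℤ∣.∣? ℤ.+ m ℤ.- ℤ.+ (N * suc j))) ≤ gcd x m
count-∣-in-window M N m x = count-≤-inhabited M Sol? λ _ sol → begin
  count M Sol?   ≤⟨ count-≤-window M Sol? (M ∸ x) (x / γ) γ window congruent ⟩
  γ              ≤⟨ ∣⇒≤ (gcd-greatest (gcd[m,n]∣m x N) (γ∣m sol)) ⟩
  gcd x m        ∎
  where
    open ≤-Reasoning
    γ = gcd x N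
    instance
      _ = gcd-nonZeroˡ x N
      _ = gcd-nonZeroˡ x m
      _ = >-nonZero (m≥n⇒m/n>0 {x} {γ} (∣⇒≤ (gcd[m,n]∣m x N)))
    Sol : ℕ → Set
    Sol j = M < x + suc j × ℤ.+ x ∣ℤ ℤ.+ m ℤ.- ℤ.+ (N * suc j)
    Sol? : Decidable Sol
    Sol? j = (M <? x + suc j) ×-dec (ℤ.+ x ℤ∣.∣? ℤ.+ m ℤ.- ℤ.+ (N * suc j))
    γ∣m : ∀ {j} → Sol j → γ ∣ m
    γ∣m {j} (_ , x∣m-Ny) = ∣ℤ-common-divisor x∣m-Ny (gcd[m,n]∣m x N) (∣m⇒∣m*n (suc j) (gcd[m,n]∣n x N))
    window : ∀ {j} → j < M → Sol j → M ∸ x ≤ j × j < (M ∸ x) + x / γ * γ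
    window {j} j<M (M<x+y , _) = map₂ (subst (j <_) (cong ((M ∸ x) +_) (sym (m/n*n≡m (gcd[m,n]∣m x N)))))
                                      (∸-window j<M M<x+y)
    congruent : ∀ {j j′} → j < M → j′ < M → Sol j → Sol j′ → j ≤ j′ → x / γ ∣ j′ ∸ j
    congruent {j} {j′} _ _ (_ , x∣m-Ny) (_ , x∣m-Ny′) j≤j′ = ∣*⇒/gcd∣ x N (subst (x ∣_)
      (sym (*-distribˡ-∸ N (suc j′) (suc j))) (∣ℤ-∸ x∣m-Ny x∣m-Ny′ (*-monoʳ-≤ N (s≤s j≤j′))))

count-multiples : ∀ d M → d * count M (λ i → d ∣? suc i) ≤ M
count-multiples zero      M = z≤n
count-multiples d@(suc _) M = begin
  d * count M (λ i → d ∣? suc i)   ≤⟨ *-monoʳ-≤ d (count-≤-window M ((d ∣?_) ∘ suc) 0 d (M / d) window congruent) ⟩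
  d * (M / d)                      ≡⟨ *-comm d (M / d) ⟩
  M / d * d                        ≤⟨ m/n*n≤m M d ⟩
  M                                ∎
  where
    open ≤-Reasoning
    window : ∀ {i} → i < M → d ∣ suc i → 0 ≤ i × i < 0 + d * (M / d)
    window {i} i<M d∣1+i = z≤n , subst (_≤ d * (M / d)) (m*[n/m]≡n d∣1+i) (*-monoʳ-≤ d (/-monoˡ-≤ d i<M))
    congruent : ∀ {i j} → i < M → j < M → d ∣ suc i → d ∣ suc j → i ≤ j → d ∣ j ∸ i
    congruent _ _ d∣1+i d∣1+j i≤j = ∣m+n∣m⇒∣n (subst (d ∣_) (sym (m+[n∸m]≡n (s≤s i≤j))) d∣1+j) d∣1+i

∑-gcd≤M*τ : ∀ M m .{{_ : NonZero m}} → ∑[ i < M ] gcd (suc i) m ≤ M * τ m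
∑-gcd≤M*τ M m = begin
  ∑[ i < M ] gcd (suc i) m
    ≤⟨ ∑-mono-≤ M (λ {i} _ → gcd≤∑ i) ⟩
  ∑[ i < M ] ∑[ d < suc m ] w d i
    ≡⟨ ∑-comm M (suc m) (λ i d → w d i) ⟩
  ∑[ d < suc m ] ∑[ i < M ] w d i
    ≡⟨ ∑-cong (suc m) (λ {d} _ → ∑w≡ d) ⟩
  ∑[ d < suc m ] (𝟙 (d ∣? m) * (d * count M (λ i → d ∣? suc i)))
    ≤⟨ ∑-mono-≤ (suc m) (λ {d} _ → *-monoʳ-≤ (𝟙 (d ∣? m)) (count-multiples d M)) ⟩
  ∑[ d < suc m ] (𝟙 (d ∣? m) * M)
    ≡⟨ ∑-cong (suc m) (λ {d} _ → *-comm (𝟙 (d ∣? m)) M) ⟩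
  ∑[ d < suc m ] (M * 𝟙 (d ∣? m))
    ≡⟨ sym (∑-*ˡ (suc m) M (λ d → 𝟙 (d ∣? m))) ⟩
  M * τ m
    ∎
  where
    open ≤-Reasoning
    w : ℕ → ℕ → ℕ
    w d i = 𝟙 (d ∣? m) * (d * 𝟙 (d ∣? suc i))
    ∑w≡ : ∀ d → ∑[ i < M ] w d i ≡ 𝟙 (d ∣? m) * (d * count M (λ i → d ∣? suc i))
    ∑w≡ d = sym (trans (cong (𝟙 (d ∣? m) *_) (∑-*ˡ M d (λ i → 𝟙 (d ∣? suc i))))
                       (∑-*ˡ M (𝟙 (d ∣? m)) (λ i → d * 𝟙 (d ∣? suc i))))
    gcd≤∑ : ∀ i → gcd (suc i) m ≤ ∑[ d < suc m ] w d i
    gcd≤∑ i =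
      ≤-trans (≤-reflexive (sym w[γ]≡γ)) (f≤∑ {f = λ d → w d i} (s≤s (∣⇒≤ (gcd[m,n]∣n (suc i) m))))
      where
        γ = gcd (suc i) m
        w[γ]≡γ : w γ i ≡ γ
        w[γ]≡γ = begin-equality
          𝟙 (γ ∣? m) * (γ * 𝟙 (γ ∣? suc i))  ≡⟨ cong₂ (λ u v → u * (γ * v)) (𝟙-yes (γ ∣? m) (gcd[m,n]∣n (suc i) m))
                                                                          (𝟙-yes (γ ∣? suc i) (gcd[m,n]∣m (suc i) m)) ⟩
          1 * (γ * 1)                        ≡⟨ *-identityˡ (γ * 1) ⟩
          γ * 1                              ≡⟨ *-identityʳ γ ⟩
          γ                                  ∎

length-filter-++ : ∀ {A : Set} {P : Pred A 0ℓ} (P? : Decidable P) (xs ys : List A) →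
  length (filter P? (xs ++ ys)) ≡ length (filter P? xs) + length (filter P? ys)
length-filter-++ P? xs ys = trans (cong length (filter-++ P? xs ys)) (length-++ (filter P? xs))

length-filter-concatMap-upTo : ∀ {A : Set} {P : Pred A 0ℓ} (P? : Decidable P) (g : ℕ → List A) n →
  length (filter P? (concatMap g (upTo n))) ≡ ∑[ i < n ] length (filter P? (g i))
length-filter-concatMap-upTo P? g zero    = refl
length-filter-concatMap-upTo P? g (suc n) = begin
  length (filter P? (concatMap g (upTo (suc n))))
    ≡⟨ cong (λ xs → length (filter P? (concatMap g xs))) (sym (applyUpTo-∷ʳ (λ i → i) n)) ⟩
  length (filter P? (concatMap g (upTo n ++ n ∷ [])))
    ≡⟨ cong (λ xs → length (filter P? xs)) (concatMap-++ g (upTo n) (n ∷ [])) ⟩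
  length (filter P? (concatMap g (upTo n) ++ (g n ++ [])))
    ≡⟨ length-filter-++ P? (concatMap g (upTo n)) (g n ++ []) ⟩
  length (filter P? (concatMap g (upTo n))) + length (filter P? (g n ++ []))
    ≡⟨ cong₂ _+_ (length-filter-concatMap-upTo P? g n)
                 (cong (λ xs → length (filter P? xs)) (++-identityʳ (g n))) ⟩
  ∑[ i < n ] length (filter P? (g i)) + length (filter P? (g n))  ∎
  where open ≡-Reasoning

length-filter-singleton : ∀ {A : Set} {P : Pred A 0ℓ} (P? : Decidable P) (x : A) →
                          length (filter P? (x ∷ [])) ≡ 𝟙 (P? x)
length-filter-singleton P? x with P? x
... | yes _ = refl
... | no _  = refl

length-filter-map-upTo : ∀ {A : Set} {P : Pred A 0ℓ} (P? : Decidable P) (h : ℕ → A) n →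
  length (filter P? (map h (upTo n))) ≡ count n (λ i → P? (h i))
length-filter-map-upTo P? h n = begin
  length (filter P? (map h (upTo n)))
    ≡⟨ cong (λ xs → length (filter P? xs))
            (trans (sym (concatMap-pure (map h (upTo n)))) (concatMap-map (_∷ []) h (upTo n))) ⟩
  length (filter P? (concatMap (λ i → h i ∷ []) (upTo n)))
    ≡⟨ length-filter-concatMap-upTo P? (λ i → h i ∷ []) n ⟩
  ∑[ i < n ] length (filter P? (h i ∷ []))
    ≡⟨ ∑-cong n (λ {i} _ → length-filter-singleton P? (h i)) ⟩
  count n (λ i → P? (h i))  ∎
  where open ≡-Reasoning

S≡∑count : ∀ N r m → S N r m ≡ ∑[ i < N ] count N (λ j → cond? N r m (i , j))
S≡∑count N r m = trans (length-filter-concatMap-upTo (cond? N r m) (λ i → map (i ,_) (upTo N)) N)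
                       (∑-cong N (λ {i} _ → length-filter-map-upTo (cond? N r m) (i ,_) N))

Cond⇒in-range : ∀ {N r m i j} .{{_ : NonZero r}} → Cond N r m (i , j) → i < N / r × j < N / r
Cond⇒in-range (_ , rx≤N , ry≤N , _) = *≤⇒≤/ rx≤N , *≤⇒≤/ ry≤N

Cond⇒M<x+y : ∀ {N r m i j} .{{_ : NonZero r}} → Cond N r m (i , j) → N / r < suc i + suc j
Cond⇒M<x+y {N} {r} {i = i} {j} (_ , _ , _ , N<r[x+y] , _) =
  m<n*o⇒m/o<n (subst (N <_) (*-comm r (suc i + suc j)) N<r[x+y])

Cond⇒cases : ∀ {N r m i j} .{{_ : NonZero r}} → Cond N r m (i , j) →
  (N / r < suc j + suc i × suc i % suc j ≡ m % suc j) ⊎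
  (N / r < suc i + suc j × ℤ.+ suc i ∣ℤ ℤ.+ m ℤ.- ℤ.+ (N * suc j))
Cond⇒cases {N} {r} {m} {i} {j} c@(_ , _ , _ , _ , isInt) with isInt-U⇒ N m (suc i) (suc j) isInt
... | inj₁ x≡m    = inj₁ (subst (N / r <_) (+-comm (suc i) (suc j)) (Cond⇒M<x+y c) , x≡m)
... | inj₂ x∣m-Ny = inj₂ (Cond⇒M<x+y c , x∣m-Ny)

S≡∑count-below : ∀ N r m .{{_ : NonZero r}} →
                 S N r m ≡ ∑[ i < N / r ] count (N / r) (λ j → cond? N r m (i , j))
S≡∑count-below N r m = begin
  S N r m                                          ≡⟨ S≡∑count N r m ⟩
  ∑[ i < N ] count N (λ j → cond? N r m (i , j))  ≡⟨ ∑-vanishing-from (m/n≤m N r) no-row ⟩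
  ∑[ i < M ] count N (λ j → cond? N r m (i , j))  ≡⟨ ∑-cong M (λ _ → ∑-vanishing-from (m/n≤m N r) no-column) ⟩
  ∑[ i < M ] count M (λ j → cond? N r m (i , j))  ∎
  where
    open ≡-Reasoning
    M = N / r
    no-row : ∀ {i} → M ≤ i → count N (λ j → cond? N r m (i , j)) ≡ 0
    no-row M≤i = count≡0 N _ (λ _ c → <⇒≱ (proj₁ (Cond⇒in-range c)) M≤i)
    no-column : ∀ {i j} → M ≤ j → 𝟙 (cond? N r m (i , j)) ≡ 0
    no-column M≤j = 𝟙-no _ (λ c → <⇒≱ (proj₂ (Cond⇒in-range c)) M≤j)

r*S≤N+N*τ : ∀ N r m .{{_ : NonZero r}} .{{_ : NonZero m}} → r * S N r m ≤ N + N * τ m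
r*S≤N+N*τ N r m = begin
  r * S N r m              ≤⟨ *-monoʳ-≤ r S≤M+M*τ ⟩
  r * (M + M * τ m)        ≡⟨ *-distribˡ-+ r M (M * τ m) ⟩
  r * M + r * (M * τ m)    ≡⟨ cong (r * M +_) (sym (*-assoc r M (τ m))) ⟩
  r * M + r * M * τ m      ≤⟨ +-mono-≤ rM≤N (*-monoˡ-≤ (τ m) rM≤N) ⟩
  N + N * τ m              ∎
  where
    open ≤-Reasoning
    M = N / r
    rM≤N : r * M ≤ N
    rM≤N = subst (_≤ N) (*-comm M r) (m/n*n≤m N r)
    ≡-mod? : ∀ i → Decidable (λ j → M < suc j + suc i × suc i % suc j ≡ m % suc j)
    ≡-mod? i j = (M <? suc j + suc i) ×-dec (suc i % suc j ≟ m % suc j)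
    ∣? : ∀ i → Decidable (λ j → M < suc i + suc j × ℤ.+ suc i ∣ℤ ℤ.+ m ℤ.- ℤ.+ (N * suc j))
    ∣? i j = (M <? suc i + suc j) ×-dec (ℤ.+ suc i ℤ∣.∣? ℤ.+ m ℤ.- ℤ.+ (N * suc j))
    ≡-mod-part : ∑[ i < M ] count M (≡-mod? i) ≤ M
    ≡-mod-part = begin
      ∑[ i < M ] count M (≡-mod? i)                ≡⟨ ∑-comm M M (λ i j → 𝟙 (≡-mod? i j)) ⟩
      ∑[ j < M ] count M (λ i → ≡-mod? i j)        ≤⟨ ∑-mono-≤ M (λ {j} _ → count-≡-mod-in-window M m (suc j)) ⟩
      ∑[ j < M ] 1                                 ≡⟨ trans (∑-const M 1) (*-identityʳ M) ⟩
      M                                            ∎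
    ∣-part : ∑[ i < M ] count M (∣? i) ≤ M * τ m
    ∣-part = ≤-trans (∑-mono-≤ M (λ {i} _ → count-∣-in-window M N m (suc i))) (∑-gcd≤M*τ M m)
    S≤M+M*τ : S N r m ≤ M + M * τ m
    S≤M+M*τ = begin
      S N r m
        ≡⟨ S≡∑count-below N r m ⟩
      ∑[ i < M ] count M (λ j → cond? N r m (i , j))
        ≤⟨ ∑-mono-≤ M (λ {i} _ → count-≤-⊎ M (λ j → cond? N r m (i , j)) (≡-mod? i) (∣? i) (λ _ → Cond⇒cases)) ⟩
      ∑[ i < M ] (count M (≡-mod? i) + count M (∣? i))
        ≡⟨ ∑-distrib-+ M (λ i → count M (≡-mod? i)) (λ i → count M (∣? i)) ⟩
      ∑[ i < M ] count M (≡-mod? i) + ∑[ i < M ] count M (∣? i)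
        ≤⟨ +-mono-≤ ≡-mod-part ∣-part ⟩
      M + M * τ m
        ∎

S*r≤2*N*τ : ∀ N r m .{{_ : NonZero r}} .{{_ : NonZero m}} → S N r m * r ≤ 2 * (N * τ m)
S*r≤2*N*τ N r m = begin
  S N r m * r          ≡⟨ *-comm (S N r m) r ⟩
  r * S N r m          ≤⟨ r*S≤N+N*τ N r m ⟩
  N + N * τ m          ≤⟨ +-monoˡ-≤ (N * τ m) (subst (_≤ N * τ m) (*-identityʳ N) (*-monoʳ-≤ N (1≤τ m))) ⟩
  N * τ m + N * τ m    ≡⟨ cong (N * τ m +_) (sym (+-identityʳ (N * τ m))) ⟩
  2 * (N * τ m)        ∎
  where open ≤-Reasoning

n≤n^k : ∀ n k .{{_ : NonZero n}} → 1 ≤ k → n ≤ n ^ k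
n≤n^k n k 1≤k = subst (_≤ n ^ k) (*-identityʳ n) (^-monoʳ-≤ n 1≤k)

proposition6p1 : (p q : ℕ) → 0 < p → 0 < q →
    Σ ℕ (λ C → (N h r : ℕ) .{{_ : NonZero r}} →
      1 ≤ N → 1 ≤ h → h ≤ 2 * (N * N) → r ∣ h → r ≤ N →
      S N r (h / r) ^ q * r ^ q ≤ C ^ q * N ^ q * (h / r) ^ p)
proposition6p1 p q 0<p 0<q = 2 * C₀ , λ N h r _ 1≤h _ r∣h _ →
  let m = h / r
      instance _ = >-nonZero (m≥n⇒m/n>0 (∣⇒≤ {{>-nonZero 1≤h}} r∣h))
  in begin
    S N r m ^ q * r ^ q                  ≡⟨ sym (^-distribʳ-* (S N r m) r q) ⟩
    (S N r m * r) ^ q                    ≤⟨ ^-monoˡ-≤ q (S*r≤2*N*τ N r m) ⟩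
    (2 * (N * τ m)) ^ q                  ≡⟨ trans (^-distribʳ-* 2 (N * τ m) q) (cong (2 ^ q *_) (^-distribʳ-* N (τ m) q)) ⟩
    2 ^ q * (N ^ q * τ m ^ q)            ≤⟨ *-monoʳ-≤ (2 ^ q) (*-monoʳ-≤ (N ^ q) (τ^q≤ q m)) ⟩
    2 ^ q * (N ^ q * (C₀ * m))           ≤⟨ *-monoʳ-≤ (2 ^ q) (*-monoʳ-≤ (N ^ q) (*-mono-≤ (n≤n^k C₀ q 0<q) (n≤n^k m p 0<p))) ⟩
    2 ^ q * (N ^ q * (C₀ ^ q * m ^ p))   ≡⟨ regroup (2 ^ q) (N ^ q) (C₀ ^ q) (m ^ p) ⟩
    2 ^ q * C₀ ^ q * N ^ q * m ^ p       ≡⟨ cong (λ c → c * N ^ q * m ^ p) (sym (^-distribʳ-* 2 C₀ q)) ⟩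
    (2 * C₀) ^ q * N ^ q * m ^ p         ∎
  where
    open ≤-Reasoning
    instance _ = >-nonZero 0<q
    C₀ = (q ^ q) ^ (2 ^ q)
    instance _ = m^n≢0 (q ^ q) (2 ^ q) {{m^n≢0 q q}}
    regroup : ∀ a b c d → a * (b * (c * d)) ≡ a * c * b * d
    regroup = ℕ-RingSolver.solve-∀
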